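{- Let $\langle\mathbb{V}(X),\mathbb{V}(X),\ast\rangle$ be a single superstructure model of nonstandard methods and let $Y$ be a set in $\mathbb{V}(X)$. The following are equivalent: (1) $Y$ is completely coherent; (2) for every $y\in Y$ we have $y={}^{\ast}y$.
   Context: A single superstructure model of nonstandard methods consists of an infinite set $X$, its superstructure $\mathbb{V}(X)$, and a star map $\ast:\mathbb{V}(X)\to\mathbb{V}(X)$ satisfying the transfer principle. A set $Y\in\mathbb{V}(X)$ is called coherent if $Y\subseteq{}^{\ast}Y$, and completely coherent if every subset $A\subseteq Y$ is coherent. -}

module Defs where

open import Level using (Level; _⊔_) renaming (suc to lsuc)
open import Data.Nat using (ℕ; zero; suc)
open import Data.Fin using (Fin; zero; suc)
open import Data.Product using (Σ; _×_; _,_)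
open import Data.Sum using (_⊎_)
open import Relation.Nullary using (¬_)
open import Relation.Binary.PropositionalEquality using (_≡_)
open import Function.Bundles using (_⇔_)
open import Function.Definitions using (Injective)

record Universe (ℓ : Level) : Set (lsuc ℓ) where
  field
    V      : Set ℓ
    _∈_    : V → V → Set ℓ
    IsAtom : V → Set ℓ

-- V_n(X):  V_0 = X,  V_{n+1} = V_n ∪ P(V_n)  (P = sets, i.e. non-atoms, of elements of V_n)
Lvl : ∀ {ℓ} (U : Universe ℓ) → ℕ → Universe.V U → Set ℓ
Lvl U zero    x = Universe.IsAtom U x
Lvl U (suc n) x = Lvl U n x ⊎ ((¬ Universe.IsAtom U x) × (∀ y → Universe._∈_ U y x → Lvl U n y))

-- Axiomatic description of a superstructure V(X) over an infinite set X of atoms.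
-- The carrier V is (exactly) the superstructure V(X); IsAtom picks out X.
record Superstructure (ℓ : Level) : Set (lsuc ℓ) where
  field
    univ : Universe ℓ
  open Universe univ public
  field
    atom-empty  : ∀ a x → IsAtom a → ¬ (x ∈ a)
    extensional : ∀ a b → ¬ IsAtom a → ¬ IsAtom b
                  → (∀ x → (x ∈ a) ⇔ (x ∈ b)) → a ≡ b
    exhaustive  : ∀ x → Σ ℕ λ n → Lvl univ n x
    -- P(V_n(X)) ⊆ V_{n+1}(X): every subset of V_n(X) is a set of V(X)
    powerset    : ∀ n (P : V → Set ℓ) → (∀ y → P y → Lvl univ n y)
                  → Σ V λ s → (¬ IsAtom s) × (∀ y → (y ∈ s) ⇔ P y)
    infinite    : Σ (ℕ → V) λ f → Injective _≡_ _≡_ f × (∀ k → IsAtom (f k))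

-- Bounded formulas of the language {∈, =} with n free variables (de Bruijn).
data Formula : ℕ → Set where
  _∈'_ : ∀ {n} → Fin n → Fin n → Formula n
  _≐_  : ∀ {n} → Fin n → Fin n → Formula n
  ¬'_  : ∀ {n} → Formula n → Formula n
  _∧'_ : ∀ {n} → Formula n → Formula n → Formula n
  _∨'_ : ∀ {n} → Formula n → Formula n → Formula n
  _⇒'_ : ∀ {n} → Formula n → Formula n → Formula n
  ∀∈   : ∀ {n} → Fin n → Formula (suc n) → Formula n   -- ∀ x ∈ v_i . φ  (x = var zero)
  ∃∈   : ∀ {n} → Fin n → Formula (suc n) → Formula n

module _ {ℓ : Level} (S : Superstructure ℓ) where
  open Superstructure S

  extend : ∀ {n} → V → (Fin n → V) → Fin (suc n) → V
  extend x ρ zero    = x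
  extend x ρ (suc i) = ρ i

  Sat : ∀ {n} → Formula n → (Fin n → V) → Set ℓ
  Sat (i ∈' j)  ρ = ρ i ∈ ρ j
  Sat (i ≐ j)   ρ = ρ i ≡ ρ j
  Sat (¬' φ)    ρ = ¬ Sat φ ρ
  Sat (φ ∧' ψ)  ρ = Sat φ ρ × Sat ψ ρ
  Sat (φ ∨' ψ)  ρ = Sat φ ρ ⊎ Sat ψ ρ
  Sat (φ ⇒' ψ)  ρ = Sat φ ρ → Sat ψ ρ
  Sat (∀∈ i φ)  ρ = ∀ x → x ∈ ρ i → Sat φ (extend x ρ)
  Sat (∃∈ i φ)  ρ = Σ V λ x → (x ∈ ρ i) × Sat φ (extend x ρ)

record SingleModel (ℓ : Level) : Set (lsuc ℓ) where
  field
    sup : Superstructure ℓ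
  open Superstructure sup public
  field
    star     : V → V
    transfer : ∀ {n} (φ : Formula n) (ρ : Fin n → V)
               → Sat sup φ ρ ⇔ Sat sup φ (λ i → star (ρ i))

  Coherent : V → Set ℓ
  Coherent Y = ∀ y → y ∈ Y → y ∈ star Y

  CompletelyCoherent : V → Set ℓ
  CompletelyCoherent Y = ∀ A → ¬ IsAtom A → (∀ a → a ∈ A → a ∈ Y) → Coherent A

-- Both directions rest on two consequences of transfer for bounded formulas:
--   * * preserves membership (transfer of  v₀ ∈ v₁), so a set all of whose
--     elements are fixed points of * is coherent; applied to subsets of Y this
--     gives "fixed points ⇒ completely coherent";
--   * if every element of s equals y, then every element of *s equals *y
--     (transfer of  ∀ x ∈ v₀. x = v₁).
-- For the converse we build the singleton {y} of any y ∈ V(X) (from the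
-- level structure and the power-set axiom).  For y ∈ Y this singleton is a
-- subset of Y, hence coherent, so y ∈ *{y} and therefore y = *y.
module Submission where

open import Defs
open import Level using (Level)
open import Relation.Nullary using (¬_)
open import Relation.Binary.PropositionalEquality using (_≡_; refl; sym; subst)
open import Function.Bundles using (_⇔_; mk⇔; Equivalence)
open import Data.Fin using (Fin; zero; suc)
open import Data.Product using (Σ; _×_; _,_)

module SingleModelFacts {ℓ : Level} (M : SingleModel ℓ) where
  open SingleModel M
  open Equivalence using (to; from)

  env₂ : V → V → Fin 2 → V
  env₂ a b zero    = a
  env₂ a b (suc _) = b

  star-preserves-∈ : ∀ {a b} → a ∈ b → star a ∈ star b
  star-preserves-∈ {a} {b} a∈b = to (transfer (zero ∈' suc zero) (env₂ a b)) a∈b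

  fixed-elements⇒coherent : ∀ A → (∀ a → a ∈ A → a ≡ star a) → Coherent A
  fixed-elements⇒coherent A fixed a a∈A =
    subst (_∈ star A) (sym (fixed a a∈A)) (star-preserves-∈ a∈A)

  star-of-constant-set : ∀ s y → (∀ x → x ∈ s → x ≡ y) → ∀ x → x ∈ star s → x ≡ star y
  star-of-constant-set s y allY =
    to (transfer (∀∈ zero (zero ≐ suc (suc zero))) (env₂ s y)) allY

  -- Every element y of V(X) has a singleton {y} in V(X): y lies in some
  -- level V_n(X), and {y} ⊆ V_n(X) is a set by the power-set axiom.
  singleton : ∀ y → Σ V λ s → (¬ IsAtom s) × (∀ z → (z ∈ s) ⇔ (z ≡ y))
  singleton y with exhaustive y
  ... | n , y∈Vₙ = powerset n (_≡ y) λ { _ refl → y∈Vₙ }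

  coherent-singleton⇒fixed : ∀ y s → (∀ z → (z ∈ s) ⇔ (z ≡ y)) → Coherent s → y ≡ star y
  coherent-singleton⇒fixed y s s-is-y coh =
    star-of-constant-set s y (λ z → to (s-is-y z)) y (coh y (from (s-is-y y) refl))

  completelyCoherent⇒fixed : ∀ Y → CompletelyCoherent Y → ∀ y → y ∈ Y → y ≡ star y
  completelyCoherent⇒fixed Y cc y y∈Y with singleton y
  ... | s , s-set , s-is-y = coherent-singleton⇒fixed y s s-is-y (cc s s-set s⊆Y)
    where
      s⊆Y : ∀ z → z ∈ s → z ∈ Y
      s⊆Y z z∈s = subst (_∈ Y) (sym (to (s-is-y z) z∈s)) y∈Y

  fixed⇒completelyCoherent : ∀ Y → (∀ y → y ∈ Y → y ≡ star y) → CompletelyCoherent Y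
  fixed⇒completelyCoherent Y fixed A _ A⊆Y =
    fixed-elements⇒coherent A λ a a∈A → fixed a (A⊆Y a a∈A)

theorem3p6 : ∀ {ℓ : Level} (M : SingleModel ℓ) (Y : SingleModel.V M)
    → ¬ SingleModel.IsAtom M Y
    → SingleModel.CompletelyCoherent M Y
    ⇔ (∀ y → SingleModel._∈_ M y Y → y ≡ SingleModel.star M y)
theorem3p6 M Y _ = mk⇔ (completelyCoherent⇒fixed Y) (fixed⇒completelyCoherent Y)
  where open SingleModelFacts M
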